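{- If $M$ is a connected matroid that is not unbreakable, then $M$ has a flat $F$ such that $M/F$ is disconnected and $r(M/F)=2$.
   Context: A matroid $M$ is unbreakable if it is connected and $M/F$ is connected for every flat $F$ of $M$. -}

module Defs where

open import Data.Nat using (ℕ; _+_; _∸_; _≤_; _<_)
open import Data.Fin using (Fin)
open import Data.Fin.Subset using (Subset; _∈_; _∉_; _⊆_; _∪_; _∩_; _─_; _-_; ⁅_⁆; ∣_∣)
open import Data.Product using (Σ; _×_; ∃)
open import Relation.Binary.PropositionalEquality using (_≡_)
open import Relation.Nullary using (¬_)

-- A "rank structure" on elements drawn from Fin n: a ground set E ⊆ Fin n
-- together with a rank function (only its values on subsets of E matter).
-- Keeping the universe Fin n fixed lets contraction change the ground set
-- without changing the type.
record RankData (n : ℕ) : Set where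
  field
    ground : Subset n
    rk     : Subset n → ℕ

open RankData public

record Matroid (n : ℕ) : Set where
  field
    rankData : RankData n
  E : Subset n
  E = ground rankData
  r : Subset n → ℕ
  r = rk rankData
  field
    R1 : ∀ X → X ⊆ E → r X ≤ ∣ X ∣
    R2 : ∀ X Y → Y ⊆ E → X ⊆ Y → r X ≤ r Y
    R3 : ∀ X Y → X ⊆ E → Y ⊆ E → r (X ∪ Y) + r (X ∩ Y) ≤ r X + r Y

open Matroid public

Independent : ∀ {n} → RankData n → Subset n → Set
Independent M I = I ⊆ ground M × rk M I ≡ ∣ I ∣

IsCircuit : ∀ {n} → RankData n → Subset n → Set
IsCircuit M C =
  C ⊆ ground M × rk M C < ∣ C ∣ × (∀ x → x ∈ C → Independent M (C - x))

Connected : ∀ {n} → RankData n → Set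
Connected M = ∀ x y → x ∈ ground M → y ∈ ground M → ¬ (x ≡ y) →
  Σ (Subset _) λ C → IsCircuit M C × x ∈ C × y ∈ C

IsFlat : ∀ {n} → Matroid n → Subset n → Set
IsFlat M F = F ⊆ E M × (∀ x → x ∈ E M → x ∉ F → r M F < r M (F ∪ ⁅ x ⁆))

contract : ∀ {n} → Matroid n → Subset n → RankData n
contract M F = record
  { ground = E M ─ F
  ; rk     = λ X → r M (X ∪ F) ∸ r M F
  }

rankOf : ∀ {n} → RankData n → ℕ
rankOf M = rk M (ground M)

Unbreakable : ∀ {n} → Matroid n → Set
Unbreakable M = Connected (rankData M) × (∀ F → IsFlat M F → Connected (contract M F))

-- If x and y lie in no common circuit of M/F for a flat F of corank at least 3, pick z
-- outside the closure of F ∪ {x, y} and let F′ = cl(F ∪ {z}), a flat of rank r(F) + 1.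
-- By the exchange property x, y ∉ F′; and as M/F′ = (M/F)/(F′ − F) and every circuit of a
-- contraction extends to a circuit of the matroid, x and y share no circuit of M/F′
-- either. Iterating brings the corank down to 2; it is never at most 1, because in a
-- contraction of rank at most 1 any two elements form a circuit. All notions involved are
-- decidable over the finite ground set, which turns the hypothesis ¬ Unbreakable M into
-- an actual flat F with elements x and y to start from.
module Submission where

open import Defs
open import Data.Nat using (ℕ; suc; _+_; _∸_; _≤_; _<_; z≤n; s≤s)
open import Data.Nat.Properties
open import Data.Fin using (Fin; zero)
open import Data.Fin.Properties using (any?; all?) renaming (_≟_ to _≟ᶠ_)
open import Data.Fin.Subset
open import Data.Fin.Subset.Properties
open import Data.Fin.Subset.Induction using (⊂-wellFounded; Acc; acc)
open import Data.Vec using ([]; _∷_; here; there; tabulate)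
open import Data.Vec.Properties using (lookup∘tabulate; []=⇒lookup; lookup⇒[]=)
open import Data.Product using (Σ; ∃; _×_; _,_; proj₁; proj₂)
import Data.Product as Product
open import Data.Sum using (inj₁; inj₂; [_,_]′)
open import Data.Empty using (⊥-elim)
open import Function using (_∘_; _$_)
open import Level using (Level)
open import Relation.Binary.PropositionalEquality
  using (_≡_; _≢_; refl; sym; trans; cong; cong₂; subst; module ≡-Reasoning)
open import Relation.Nullary using (¬_; Dec; yes; no; does; proof)
open import Relation.Nullary.Reflects using (Reflects; invert)
open import Relation.Nullary.Decidable using (_×-dec_; _→-dec_; ¬?; decidable-stable; dec-true)
open import Relation.Unary using (Pred; Decidable)
import Algebra.Solver.IdempotentCommutativeMonoid as ∪-Solver

private
  variable
    ℓ : Level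
    n : ℕ
    p q s : Subset n
    x y : Fin n

x∈p─q⁻ : ∀ (p q : Subset n) → x ∈ p ─ q → x ∈ p × x ∉ q
x∈p─q⁻ (inside ∷ p) (outside ∷ q) here = here , λ ()
x∈p─q⁻ {x = zero} (outside ∷ p) (outside ∷ q) ()
x∈p─q⁻ {x = zero} (_ ∷ p) (inside ∷ q) ()
x∈p─q⁻ (_ ∷ p) (_ ∷ q) (there x∈) = Product.map there (_∘ drop-there) (x∈p─q⁻ p q x∈)

∪-least : p ⊆ s → q ⊆ s → p ∪ q ⊆ s
∪-least {p = p} {q = q} p⊆s q⊆s x∈ = [ p⊆s , q⊆s ]′ (x∈p∪q⁻ p q x∈)

∪-monoˡ-⊆ : p ⊆ q → p ∪ s ⊆ q ∪ s
∪-monoˡ-⊆ {q = q} {s = s} p⊆q = ∪-least (p⊆p∪q s ∘ p⊆q) (q⊆p∪q q s)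

∪-monoʳ-⊆ : q ⊆ s → p ∪ q ⊆ p ∪ s
∪-monoʳ-⊆ {s = s} {p = p} q⊆s = ∪-least (p⊆p∪q s) (q⊆p∪q p s ∘ q⊆s)

p⊆q⇒p─s⊆q─s : p ⊆ q → p ─ s ⊆ q ─ s
p⊆q⇒p─s⊆q─s {p = p} {s = s} p⊆q x∈p─s =
  let (x∈p , x∉s) = x∈p─q⁻ p s x∈p─s in x∈p∧x∉q⇒x∈p─q (p⊆q x∈p) x∉s

x∈p⇒⁅x⁆⊆p : x ∈ p → ⁅ x ⁆ ⊆ p
x∈p⇒⁅x⁆⊆p {x = x} {p = p} x∈p y∈ = subst (_∈ p) (sym (x∈⁅y⁆⇒x≡y x y∈)) x∈p

x∈p⇒p∪⁅x⁆≡p : x ∈ p → p ∪ ⁅ x ⁆ ≡ p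
x∈p⇒p∪⁅x⁆≡p x∈p = ⊆-antisym (∪-least ⊆-refl (x∈p⇒⁅x⁆⊆p x∈p)) (p⊆p∪q _)

x∈p⇒p-x∪⁅x⁆≡p : x ∈ p → (p - x) ∪ ⁅ x ⁆ ≡ p
x∈p⇒p-x∪⁅x⁆≡p {x = x} {p = p} x∈p = ⊆-antisym (∪-least (p─q⊆p p _) (x∈p⇒⁅x⁆⊆p x∈p)) split
  where
  split : p ⊆ (p - x) ∪ ⁅ x ⁆
  split {y} y∈p with y ≟ᶠ x
  ... | yes refl = q⊆p∪q (p - x) ⁅ x ⁆ (x∈⁅x⁆ x)
  ... | no y≢x   = p⊆p∪q ⁅ x ⁆ (x∈p∧x≢y⇒x∈p-y y∈p y≢x)

p⊆q⇒q─p∪p≡q : p ⊆ q → (q ─ p) ∪ p ≡ q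
p⊆q⇒q─p∪p≡q {p = p} {q = q} p⊆q = ⊆-antisym (∪-least (p─q⊆p q p) p⊆q) split
  where
  split : q ⊆ (q ─ p) ∪ p
  split {y} y∈q with y ∈? p
  ... | yes y∈p = q⊆p∪q (q ─ p) p y∈p
  ... | no y∉p  = p⊆p∪q p (x∈p∧x∉q⇒x∈p─q y∈q y∉p)

p⊆q⇒s─q≡s─p─[q─p] : p ⊆ q → s ─ q ≡ s ─ p ─ (q ─ p)
p⊆q⇒s─q≡s─p─[q─p] {p = p} {q = q} {s = s} p⊆q = begin
  s ─ q                ≡⟨ cong (s ─_) (p⊆q⇒q─p∪p≡q p⊆q) ⟨
  s ─ ((q ─ p) ∪ p)    ≡⟨ cong (s ─_) (∪-comm (q ─ p) p) ⟩
  s ─ (p ∪ (q ─ p))    ≡⟨ p─q─r≡p─q∪r s p (q ─ p) ⟨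
  s ─ p ─ (q ─ p)      ∎
  where open ≡-Reasoning

module _ {n : ℕ} where
  open ∪-Solver (∪-idempotentCommutativeMonoid n)

  ∪-distribʳ-∪ : ∀ (p q r : Subset n) → (p ∪ r) ∪ (q ∪ r) ≡ (p ∪ q) ∪ r
  ∪-distribʳ-∪ = solve 3 (λ p q r → (p ⊕ r) ⊕ (q ⊕ r) ⊜ (p ⊕ q) ⊕ r) refl

  ∪-swapʳ : ∀ (p q r : Subset n) → (p ∪ q) ∪ r ≡ (p ∪ r) ∪ q
  ∪-swapʳ = solve 3 (λ p q r → (p ⊕ q) ⊕ r ⊜ (p ⊕ r) ⊕ q) refl

∣p∪q∣+∣p∩q∣≡∣p∣+∣q∣ : ∀ (p q : Subset n) → ∣ p ∪ q ∣ + ∣ p ∩ q ∣ ≡ ∣ p ∣ + ∣ q ∣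
∣p∪q∣+∣p∩q∣≡∣p∣+∣q∣ [] [] = refl
∣p∪q∣+∣p∩q∣≡∣p∣+∣q∣ (inside ∷ p) (inside ∷ q) =
  cong suc (trans (+-suc _ _) (trans (cong suc (∣p∪q∣+∣p∩q∣≡∣p∣+∣q∣ p q)) (sym (+-suc _ _))))
∣p∪q∣+∣p∩q∣≡∣p∣+∣q∣ (inside ∷ p) (outside ∷ q) = cong suc (∣p∪q∣+∣p∩q∣≡∣p∣+∣q∣ p q)
∣p∪q∣+∣p∩q∣≡∣p∣+∣q∣ (outside ∷ p) (inside ∷ q) =
  trans (cong suc (∣p∪q∣+∣p∩q∣≡∣p∣+∣q∣ p q)) (sym (+-suc _ _))
∣p∪q∣+∣p∩q∣≡∣p∣+∣q∣ (outside ∷ p) (outside ∷ q) = ∣p∪q∣+∣p∩q∣≡∣p∣+∣q∣ p q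

∣p∪q∣≡∣p∣+∣q∣ : ∀ (p q : Subset n) → (∀ {x} → x ∈ p → x ∉ q) → ∣ p ∪ q ∣ ≡ ∣ p ∣ + ∣ q ∣
∣p∪q∣≡∣p∣+∣q∣ {n} p q disjoint = begin
  ∣ p ∪ q ∣               ≡⟨ +-identityʳ _ ⟨
  ∣ p ∪ q ∣ + 0           ≡⟨ cong (∣ p ∪ q ∣ +_) ∣p∩q∣≡0 ⟨
  ∣ p ∪ q ∣ + ∣ p ∩ q ∣   ≡⟨ ∣p∪q∣+∣p∩q∣≡∣p∣+∣q∣ p q ⟩
  ∣ p ∣ + ∣ q ∣           ∎
  where
  open ≡-Reasoning
  ∣p∩q∣≡0 : ∣ p ∩ q ∣ ≡ 0
  ∣p∩q∣≡0 = trans (cong ∣_∣ (Empty-unique λ (_ , x∈) → Product.uncurry disjoint (x∈p∩q⁻ p q x∈)))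
                  (∣⊥∣≡0 n)

x∈p⇒∣p∣≡1+∣p-x∣ : x ∈ p → ∣ p ∣ ≡ suc ∣ p - x ∣
x∈p⇒∣p∣≡1+∣p-x∣ {x = x} {p = p} x∈p = begin
  ∣ p ∣                   ≡⟨ cong ∣_∣ (x∈p⇒p-x∪⁅x⁆≡p x∈p) ⟨
  ∣ (p - x) ∪ ⁅ x ⁆ ∣     ≡⟨ ∣p∪q∣≡∣p∣+∣q∣ (p - x) ⁅ x ⁆ (proj₂ ∘ x∈p─q⁻ p ⁅ x ⁆) ⟩
  ∣ p - x ∣ + ∣ ⁅ x ⁆ ∣   ≡⟨ cong (∣ p - x ∣ +_) (∣⁅x⁆∣≡1 x) ⟩
  ∣ p - x ∣ + 1           ≡⟨ +-comm _ 1 ⟩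
  suc ∣ p - x ∣           ∎
  where open ≡-Reasoning

0<∣p∣⇒Nonempty : 0 < ∣ p ∣ → Nonempty p
0<∣p∣⇒Nonempty {n} {p} 0<∣p∣ with nonempty? p
... | yes nonempty = nonempty
... | no empty     = ⊥-elim (<⇒≢ 0<∣p∣ (sym (trans (cong ∣_∣ (Empty-unique empty)) (∣⊥∣≡0 n))))

⁅x⁆∪⁅y⁆-x≡⁅y⁆ : x ≢ y → (⁅ x ⁆ ∪ ⁅ y ⁆) - x ≡ ⁅ y ⁆
⁅x⁆∪⁅y⁆-x≡⁅y⁆ {x = x} {y = y} x≢y = ⊆-antisym ⊆₁ ⊆₂
  where
  ⊆₁ : (⁅ x ⁆ ∪ ⁅ y ⁆) - x ⊆ ⁅ y ⁆
  ⊆₁ z∈ with x∈p─q⁻ (⁅ x ⁆ ∪ ⁅ y ⁆) ⁅ x ⁆ z∈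
  ... | z∈x∪y , z∉x = [ ⊥-elim ∘ z∉x , (λ z∈y → z∈y) ]′ (x∈p∪q⁻ ⁅ x ⁆ ⁅ y ⁆ z∈x∪y)
  ⊆₂ : ⁅ y ⁆ ⊆ (⁅ x ⁆ ∪ ⁅ y ⁆) - x
  ⊆₂ z∈y = x∈p∧x≢y⇒x∈p-y (q⊆p∪q ⁅ x ⁆ ⁅ y ⁆ z∈y) (λ z≡x → x≢y (trans (sym z≡x) (x∈⁅y⁆⇒x≡y y z∈y)))

∣⁅x⁆∪⁅y⁆∣≡2 : x ≢ y → ∣ ⁅ x ⁆ ∪ ⁅ y ⁆ ∣ ≡ 2
∣⁅x⁆∪⁅y⁆∣≡2 {x = x} {y = y} x≢y =
  trans (∣p∪q∣≡∣p∣+∣q∣ ⁅ x ⁆ ⁅ y ⁆ disjoint) (cong₂ _+_ (∣⁅x⁆∣≡1 x) (∣⁅x⁆∣≡1 y))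
  where
  disjoint : ∀ {z} → z ∈ ⁅ x ⁆ → z ∉ ⁅ y ⁆
  disjoint z∈x z∈y = x≢y (trans (sym (x∈⁅y⁆⇒x≡y x z∈x)) (x∈⁅y⁆⇒x≡y y z∈y))

select : {P : Pred (Fin n) ℓ} → Decidable P → Subset n
select P? = tabulate (does ∘ P?)

x∈select⁻ : {P : Pred (Fin n) ℓ} (P? : Decidable P) → x ∈ select P? → P x
x∈select⁻ {x = x} P? x∈ = invert (subst (Reflects _) does≡true (proof (P? x)))
  where
  does≡true : does (P? x) ≡ inside
  does≡true = trans (sym (lookup∘tabulate (does ∘ P?) x)) ([]=⇒lookup x∈)

x∈select⁺ : {P : Pred (Fin n) ℓ} (P? : Decidable P) → P x → x ∈ select P?
x∈select⁺ {x = x} P? Px =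
  lookup⇒[]= x _ (trans (lookup∘tabulate (does ∘ P?) x) (dec-true (P? x) Px))

[m∸o]+[n∸o]≡[m+n]∸[o+o] : ∀ {m n o} → o ≤ m → o ≤ n → (m ∸ o) + (n ∸ o) ≡ (m + n) ∸ (o + o)
[m∸o]+[n∸o]≡[m+n]∸[o+o] {m} {n} {o} o≤m o≤n = begin
  (m ∸ o) + (n ∸ o)   ≡⟨ +-∸-assoc (m ∸ o) o≤n ⟨
  ((m ∸ o) + n) ∸ o   ≡⟨ cong (_∸ o) (+-∸-comm n o≤m) ⟨
  ((m + n) ∸ o) ∸ o   ≡⟨ ∸-+-assoc (m + n) o o ⟩
  (m + n) ∸ (o + o)   ∎
  where open ≡-Reasoning

[m∸o]∸[n∸o]≡m∸n : ∀ m {n o} → o ≤ n → (m ∸ o) ∸ (n ∸ o) ≡ m ∸ n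
[m∸o]∸[n∸o]≡m∸n m {n} {o} o≤n = trans (∸-+-assoc m o (n ∸ o)) (cong (m ∸_) (m+[n∸m]≡n o≤n))

InCommonCircuit : RankData n → Fin n → Fin n → Set
InCommonCircuit R x y = ∃ λ C → IsCircuit R C × x ∈ C × y ∈ C

independent? : (R : RankData n) → Decidable (Independent R)
independent? R I = (I ⊆? ground R) ×-dec (rk R I ≟ ∣ I ∣)

isCircuit? : (R : RankData n) → Decidable (IsCircuit R)
isCircuit? R C =
  (C ⊆? ground R) ×-dec (rk R C <? ∣ C ∣) ×-dec all? λ x → (x ∈? C) →-dec independent? R (C - x)

inCommonCircuit? : (R : RankData n) → ∀ x y → Dec (InCommonCircuit R x y)
inCommonCircuit? R x y = anySubset? λ C → isCircuit? R C ×-dec (x ∈? C) ×-dec (y ∈? C)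

connected? : (R : RankData n) → Dec (Connected R)
connected? R = all? λ x → all? λ y →
  (x ∈? ground R) →-dec (y ∈? ground R) →-dec ¬? (x ≟ᶠ y) →-dec inCommonCircuit? R x y

isFlat? : (M : Matroid n) → Decidable (IsFlat M)
isFlat? M F =
  (F ⊆? E M) ×-dec all? λ x → (x ∈? E M) →-dec ¬? (x ∈? F) →-dec (r M F <? r M (F ∪ ⁅ x ⁆))

_≋_ : RankData n → RankData n → Set
R₁ ≋ R₂ = ground R₁ ≡ ground R₂ × (∀ X → X ⊆ ground R₁ → rk R₁ X ≡ rk R₂ X)

IsCircuit-resp-≋ : ∀ {R₁ R₂ : RankData n} {C} → R₁ ≋ R₂ → IsCircuit R₁ C → IsCircuit R₂ C
IsCircuit-resp-≋ {C = C} (E₁≡E₂ , r₁≗r₂) (C⊆E , dep , minimal) =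
  subst (C ⊆_) E₁≡E₂ C⊆E ,
  subst (_< ∣ C ∣) (r₁≗r₂ C C⊆E) dep ,
  λ x x∈C → let (C-x⊆E , indep) = minimal x x∈C in
    subst (C - x ⊆_) E₁≡E₂ C-x⊆E , trans (sym (r₁≗r₂ (C - x) C-x⊆E)) indep

module MatroidTheory {n : ℕ} (M : Matroid n) where

  private
    module M = Matroid M
    variable
      A A′ B C D F H I J S X Y Z : Subset n
      z : Fin n

  r-mono : Y ⊆ M.E → X ⊆ Y → M.r X ≤ M.r Y
  r-mono = M.R2 _ _

  r-submodular : X ⊆ M.E → Y ⊆ M.E → M.r (X ∪ Y) + M.r (X ∩ Y) ≤ M.r X + M.r Y
  r-submodular = M.R3 _ _

  r-∪≤+ : X ⊆ M.E → Y ⊆ M.E → M.r (X ∪ Y) ≤ M.r X + M.r Y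
  r-∪≤+ X⊆E Y⊆E = ≤-trans (m≤m+n _ _) (r-submodular X⊆E Y⊆E)

  r-∪⁅⁆≤1+ : X ⊆ M.E → z ∈ M.E → M.r (X ∪ ⁅ z ⁆) ≤ suc (M.r X)
  r-∪⁅⁆≤1+ {X} {z} X⊆E z∈E = begin
    M.r (X ∪ ⁅ z ⁆)     ≤⟨ r-∪≤+ X⊆E (x∈p⇒⁅x⁆⊆p z∈E) ⟩
    M.r X + M.r ⁅ z ⁆   ≤⟨ +-monoʳ-≤ (M.r X) (M.R1 ⁅ z ⁆ (x∈p⇒⁅x⁆⊆p z∈E)) ⟩
    M.r X + ∣ ⁅ z ⁆ ∣   ≡⟨ cong (M.r X +_) (∣⁅x⁆∣≡1 z) ⟩
    M.r X + 1           ≡⟨ +-comm (M.r X) 1 ⟩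
    suc (M.r X)         ∎
    where open ≤-Reasoning

  ⊆E─F⇒⊆E : X ⊆ M.E ─ F → X ⊆ M.E
  ⊆E─F⇒⊆E X⊆E─F = ⊆-trans X⊆E─F (p─q⊆p _ _)

  independent-⊆ : Independent M.rankData I → J ⊆ I → Independent M.rankData J
  independent-⊆ {I} {J} (I⊆E , rI≡∣I∣) J⊆I =
    J⊆E , ≤-antisym (M.R1 J J⊆E) (+-cancelʳ-≤ ∣ I ─ J ∣ ∣ J ∣ (M.r J) ∣J∣+∣I─J∣≤rJ+∣I─J∣)
    where
    open ≤-Reasoning
    J⊆E : J ⊆ M.E
    J⊆E = ⊆-trans J⊆I I⊆E
    I─J⊆E : I ─ J ⊆ M.E
    I─J⊆E = ⊆-trans (p─q⊆p I J) I⊆E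
    J∪[I─J]≡I : J ∪ (I ─ J) ≡ I
    J∪[I─J]≡I = trans (∪-comm J (I ─ J)) (p⊆q⇒q─p∪p≡q J⊆I)
    ∣J∣+∣I─J∣≤rJ+∣I─J∣ : ∣ J ∣ + ∣ I ─ J ∣ ≤ M.r J + ∣ I ─ J ∣
    ∣J∣+∣I─J∣≤rJ+∣I─J∣ = begin
      ∣ J ∣ + ∣ I ─ J ∣     ≡⟨ ∣p∪q∣≡∣p∣+∣q∣ J (I ─ J) (λ x∈J → (_$ x∈J) ∘ proj₂ ∘ x∈p─q⁻ I J) ⟨
      ∣ J ∪ (I ─ J) ∣       ≡⟨ cong ∣_∣ J∪[I─J]≡I ⟩
      ∣ I ∣                 ≡⟨ rI≡∣I∣ ⟨
      M.r I                 ≡⟨ cong M.r J∪[I─J]≡I ⟨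
      M.r (J ∪ (I ─ J))     ≤⟨ r-∪≤+ J⊆E I─J⊆E ⟩
      M.r J + M.r (I ─ J)   ≤⟨ +-monoʳ-≤ (M.r J) (M.R1 (I ─ J) I─J⊆E) ⟩
      M.r J + ∣ I ─ J ∣     ∎

  Spans : Subset n → Fin n → Set
  Spans X z = M.r (X ∪ ⁅ z ⁆) ≤ M.r X

  spans? : ∀ X → Decidable (Spans X)
  spans? X z = M.r (X ∪ ⁅ z ⁆) ≤? M.r X

  Spans-mono : A ⊆ A′ → A′ ⊆ M.E → z ∈ M.E → Spans A z → Spans A′ z
  Spans-mono {A} {A′} {z} A⊆A′ A′⊆E z∈E A-spans =
    +-cancelʳ-≤ (M.r A) (M.r (A′ ∪ ⁅ z ⁆)) (M.r A′) (begin
      M.r (A′ ∪ ⁅ z ⁆) + M.r A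
        ≤⟨ +-monoʳ-≤ _ (r-mono (⊆-trans (p∩q⊆p A′ _) A′⊆E) A⊆A′∩[A∪z]) ⟩
      M.r (A′ ∪ ⁅ z ⁆) + M.r (A′ ∩ (A ∪ ⁅ z ⁆))
        ≡⟨ cong (λ U → M.r U + M.r (A′ ∩ (A ∪ ⁅ z ⁆))) A′∪A∪z≡A′∪z ⟨
      M.r (A′ ∪ A ∪ ⁅ z ⁆) + M.r (A′ ∩ (A ∪ ⁅ z ⁆))
        ≤⟨ r-submodular A′⊆E (∪-least (⊆-trans A⊆A′ A′⊆E) (x∈p⇒⁅x⁆⊆p z∈E)) ⟩
      M.r A′ + M.r (A ∪ ⁅ z ⁆)
        ≤⟨ +-monoʳ-≤ (M.r A′) A-spans ⟩
      M.r A′ + M.r A ∎)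
    where
    open ≤-Reasoning
    A⊆A′∩[A∪z] : A ⊆ A′ ∩ (A ∪ ⁅ z ⁆)
    A⊆A′∩[A∪z] x∈A = x∈p∩q⁺ (A⊆A′ x∈A , p⊆p∪q ⁅ z ⁆ x∈A)
    A′∪A∪z≡A′∪z : A′ ∪ A ∪ ⁅ z ⁆ ≡ A′ ∪ ⁅ z ⁆
    A′∪A∪z≡A′∪z = trans (sym (∪-assoc A′ A ⁅ z ⁆))
                        (cong (_∪ ⁅ z ⁆) (⊆-antisym (∪-least ⊆-refl A⊆A′) (p⊆p∪q A)))

  spans-all : A ⊆ M.E → Z ⊆ M.E → (∀ {z} → z ∈ Z → Spans A z) → M.r (A ∪ Z) ≤ M.r A
  spans-all {A} A⊆E = go _ (⊂-wellFounded _)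
    where
    go : ∀ Z → Acc _⊂_ Z → Z ⊆ M.E → (∀ {z} → z ∈ Z → Spans A z) → M.r (A ∪ Z) ≤ M.r A
    go Z (acc rs) Z⊆E A-spans with nonempty? Z
    ... | no empty =
      ≤-reflexive (cong M.r (trans (cong (A ∪_) (Empty-unique empty)) (∪-identityʳ A)))
    ... | yes (z , z∈Z) = begin
      M.r (A ∪ Z)                   ≡⟨ cong M.r A∪[Z-z]∪z≡A∪Z ⟨
      M.r ((A ∪ (Z - z)) ∪ ⁅ z ⁆)   ≤⟨ Spans-mono (p⊆p∪q _) A∪[Z-z]⊆E (Z⊆E z∈Z) (A-spans z∈Z) ⟩
      M.r (A ∪ (Z - z))             ≤⟨ go (Z - z) (rs (x∈p⇒p-x⊂p z∈Z)) Z-z⊆E (A-spans ∘ p─q⊆p Z _) ⟩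
      M.r A                         ∎
      where
      open ≤-Reasoning
      Z-z⊆E : Z - z ⊆ M.E
      Z-z⊆E = ⊆-trans (p─q⊆p Z _) Z⊆E
      A∪[Z-z]⊆E : A ∪ (Z - z) ⊆ M.E
      A∪[Z-z]⊆E = ∪-least A⊆E Z-z⊆E
      A∪[Z-z]∪z≡A∪Z : (A ∪ (Z - z)) ∪ ⁅ z ⁆ ≡ A ∪ Z
      A∪[Z-z]∪z≡A∪Z = trans (∪-assoc A (Z - z) ⁅ z ⁆) (cong (A ∪_) (x∈p⇒p-x∪⁅x⁆≡p z∈Z))

  dependent⇒circuit : D ⊆ M.E → M.r D < ∣ D ∣ → ∃ λ C → IsCircuit M.rankData C × C ⊆ D
  dependent⇒circuit = go _ (⊂-wellFounded _)
    where
    go : ∀ D → Acc _⊂_ D → D ⊆ M.E → M.r D < ∣ D ∣ → ∃ λ C → IsCircuit M.rankData C × C ⊆ D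
    go D (acc rs) D⊆E D-dep with any? (λ x → (x ∈? D) ×-dec ¬? (independent? M.rankData (D - x)))
    ... | yes (x , x∈D , D-x-dep) =
      let (C , circuit , C⊆D-x) = go (D - x) (rs (x∈p⇒p-x⊂p x∈D)) D-x⊆E
                                     (≤∧≢⇒< (M.R1 (D - x) D-x⊆E) (D-x-dep ∘ (D-x⊆E ,_)))
      in C , circuit , ⊆-trans C⊆D-x (p─q⊆p D _)
      where
      D-x⊆E : D - x ⊆ M.E
      D-x⊆E = ⊆-trans (p─q⊆p D _) D⊆E
    ... | no minimal = D , (D⊆E , D-dep , λ x x∈D →
      decidable-stable (independent? M.rankData (D - x)) (minimal ∘ (x ,_) ∘ (x∈D ,_))) , ⊆-refl

  circuit⇒spans : IsCircuit M.rankData C → z ∈ C → Spans (C - z) z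
  circuit⇒spans {C} {z} (_ , C-dep , minimal) z∈C = ≤-pred (begin-strict
    M.r ((C - z) ∪ ⁅ z ⁆)   ≡⟨ cong M.r (x∈p⇒p-x∪⁅x⁆≡p z∈C) ⟩
    M.r C                   <⟨ C-dep ⟩
    ∣ C ∣                   ≡⟨ x∈p⇒∣p∣≡1+∣p-x∣ z∈C ⟩
    suc ∣ C - z ∣           ≡⟨ cong suc (proj₂ (minimal z z∈C)) ⟨
    suc (M.r (C - z))       ∎)
    where open ≤-Reasoning

  circuit-element-removable : S ⊆ M.E → IsCircuit M.rankData C → C ⊆ S → z ∈ C → M.r (S - z) ≡ M.r S
  circuit-element-removable {S} {C} {z} S⊆E circuit C⊆S z∈C = ≤-antisym
    (r-mono S⊆E (p─q⊆p S _))
    (subst (λ U → M.r U ≤ M.r (S - z)) (x∈p⇒p-x∪⁅x⁆≡p (C⊆S z∈C)) S-z-spans)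
    where
    S-z-spans : Spans (S - z) z
    S-z-spans = Spans-mono (p⊆q⇒p─s⊆q─s C⊆S) (⊆-trans (p─q⊆p S _) S⊆E) (S⊆E (C⊆S z∈C))
                           (circuit⇒spans circuit z∈C)

  Basis : Subset n → Subset n → Set
  Basis S B = B ⊆ S × Independent M.rankData B × M.r B ≡ M.r S

  basis : S ⊆ M.E → ∃ (Basis S)
  basis = go _ (⊂-wellFounded _)
    where
    go : ∀ S → Acc _⊂_ S → S ⊆ M.E → ∃ (Basis S)
    go S (acc rs) S⊆E with M.r S ≟ ∣ S ∣
    ... | yes S-indep = S , ⊆-refl , (S⊆E , S-indep) , refl
    ... | no S-dep with dependent⇒circuit S⊆E (≤∧≢⇒< (M.R1 S S⊆E) S-dep)
    ... | C , circuit@(_ , C-dep , _) , C⊆S with 0<∣p∣⇒Nonempty (≤-trans (s≤s z≤n) C-dep)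
    ... | z , z∈C with go (S - z) (rs (x∈p⇒p-x⊂p (C⊆S z∈C))) (⊆-trans (p─q⊆p S _) S⊆E)
    ... | B , B⊆S-z , B-indep , rB≡r[S-z] =
      B , ⊆-trans B⊆S-z (p─q⊆p S _) , B-indep ,
      trans rB≡r[S-z] (circuit-element-removable S⊆E circuit C⊆S z∈C)

  r-∪-spanning : S ⊆ M.E → B ⊆ S → M.r B ≡ M.r S → X ⊆ M.E → M.r (X ∪ B) ≡ M.r (X ∪ S)
  r-∪-spanning {S} {B} {X} S⊆E B⊆S rB≡rS X⊆E =
    ≤-antisym (r-mono (∪-least X⊆E S⊆E) (∪-monoʳ-⊆ B⊆S)) (begin
      M.r (X ∪ S)         ≤⟨ r-mono (∪-least X∪B⊆E S⊆E) (∪-monoˡ-⊆ (p⊆p∪q B)) ⟩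
      M.r ((X ∪ B) ∪ S)   ≤⟨ spans-all X∪B⊆E S⊆E X∪B-spans ⟩
      M.r (X ∪ B)         ∎)
    where
    open ≤-Reasoning
    X∪B⊆E : X ∪ B ⊆ M.E
    X∪B⊆E = ∪-least X⊆E (⊆-trans B⊆S S⊆E)
    X∪B-spans : z ∈ S → Spans (X ∪ B) z
    X∪B-spans {z} z∈S = Spans-mono (q⊆p∪q X B) X∪B⊆E (S⊆E z∈S)
      (≤-trans (r-mono S⊆E (∪-least B⊆S (x∈p⇒⁅x⁆⊆p z∈S))) (≤-reflexive (sym rB≡rS)))

  InClosure : Subset n → Fin n → Set
  InClosure X z = z ∈ M.E × Spans X z

  inClosure? : ∀ X → Decidable (InClosure X)
  inClosure? X z = (z ∈? M.E) ×-dec spans? X z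

  cl : Subset n → Subset n
  cl X = select (inClosure? X)

  x∈cl⁻ : z ∈ cl X → InClosure X z
  x∈cl⁻ = x∈select⁻ (inClosure? _)

  x∈cl⁺ : z ∈ M.E → Spans X z → z ∈ cl X
  x∈cl⁺ z∈E X-spans = x∈select⁺ (inClosure? _) (z∈E , X-spans)

  cl⊆E : cl X ⊆ M.E
  cl⊆E = proj₁ ∘ x∈cl⁻

  ⊆cl : X ⊆ M.E → X ⊆ cl X
  ⊆cl X⊆E z∈X = x∈cl⁺ (X⊆E z∈X) (≤-reflexive (cong M.r (x∈p⇒p∪⁅x⁆≡p z∈X)))

  r-cl : X ⊆ M.E → M.r (cl X) ≡ M.r X
  r-cl {X} X⊆E = ≤-antisym
    (≤-trans (r-mono (∪-least X⊆E cl⊆E) (q⊆p∪q X (cl X))) (spans-all X⊆E cl⊆E (proj₂ ∘ x∈cl⁻)))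
    (r-mono cl⊆E (⊆cl X⊆E))

  cl-flat : X ⊆ M.E → IsFlat M (cl X)
  cl-flat {X} X⊆E = cl⊆E , λ z z∈E z∉cl → begin-strict
    M.r (cl X)           ≡⟨ r-cl X⊆E ⟩
    M.r X                <⟨ ≰⇒> (z∉cl ∘ x∈cl⁺ z∈E) ⟩
    M.r (X ∪ ⁅ z ⁆)      ≤⟨ r-mono (∪-least cl⊆E (x∈p⇒⁅x⁆⊆p z∈E)) (∪-monoˡ-⊆ (⊆cl X⊆E)) ⟩
    M.r (cl X ∪ ⁅ z ⁆)   ∎
    where open ≤-Reasoning

  flat-r-∪⁅⁆ : IsFlat M F → z ∈ M.E → z ∉ F → M.r (F ∪ ⁅ z ⁆) ≡ suc (M.r F)
  flat-r-∪⁅⁆ (F⊆E , F-flat) z∈E z∉F = ≤-antisym (r-∪⁅⁆≤1+ F⊆E z∈E) (F-flat _ z∈E z∉F)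

  flat-exchange : ∀ {x} → IsFlat M F → x ∈ M.E → x ∉ F → z ∈ M.E →
                  Spans (F ∪ ⁅ z ⁆) x → Spans (F ∪ ⁅ x ⁆) z
  flat-exchange {F} {z} {x} flat x∈E x∉F z∈E F∪z-spans-x = begin
    M.r ((F ∪ ⁅ x ⁆) ∪ ⁅ z ⁆)   ≡⟨ cong M.r (∪-swapʳ F ⁅ x ⁆ ⁅ z ⁆) ⟩
    M.r ((F ∪ ⁅ z ⁆) ∪ ⁅ x ⁆)   ≤⟨ F∪z-spans-x ⟩
    M.r (F ∪ ⁅ z ⁆)             ≤⟨ r-∪⁅⁆≤1+ (proj₁ flat) z∈E ⟩
    suc (M.r F)                 ≡⟨ flat-r-∪⁅⁆ flat x∈E x∉F ⟨
    M.r (F ∪ ⁅ x ⁆)             ∎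
    where open ≤-Reasoning

  ∃-unspanned : X ⊆ M.E → M.r X < M.r M.E → ∃ λ z → z ∈ M.E × ¬ Spans X z
  ∃-unspanned {X} X⊆E rX<rE with any? (λ z → (z ∈? M.E) ×-dec ¬? (spans? X z))
  ... | yes unspanned = unspanned
  ... | no none = ⊥-elim (<⇒≱ rX<rE (begin
    M.r M.E         ≤⟨ r-mono (∪-least X⊆E ⊆-refl) (q⊆p∪q X M.E) ⟩
    M.r (X ∪ M.E)   ≤⟨ spans-all X⊆E ⊆-refl (λ {z} z∈E →
                         decidable-stable (spans? X z) (none ∘ (z ,_) ∘ (z∈E ,_))) ⟩
    M.r X           ∎))
    where open ≤-Reasoning

  contraction : F ⊆ M.E → Matroid n
  contraction {F} F⊆E = record
    { rankData = contract M F ; R1 = contract-R1 ; R2 = contract-R2 ; R3 = contract-R3 }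
    where
    rF≤r[X∪F] : ∀ {X} → X ⊆ M.E → M.r F ≤ M.r (X ∪ F)
    rF≤r[X∪F] X⊆E = r-mono (∪-least X⊆E F⊆E) (q⊆p∪q _ F)

    contract-R1 : ∀ X → X ⊆ M.E ─ F → M.r (X ∪ F) ∸ M.r F ≤ ∣ X ∣
    contract-R1 X X⊆E─F = begin
      M.r (X ∪ F) ∸ M.r F       ≤⟨ ∸-monoˡ-≤ (M.r F) r[X∪F]≤∣X∣+rF ⟩
      (∣ X ∣ + M.r F) ∸ M.r F   ≡⟨ m+n∸n≡m ∣ X ∣ (M.r F) ⟩
      ∣ X ∣                     ∎
      where
      open ≤-Reasoning
      X⊆E : X ⊆ M.E
      X⊆E = ⊆E─F⇒⊆E X⊆E─F
      r[X∪F]≤∣X∣+rF : M.r (X ∪ F) ≤ ∣ X ∣ + M.r F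
      r[X∪F]≤∣X∣+rF = ≤-trans (r-∪≤+ X⊆E F⊆E) (+-monoˡ-≤ (M.r F) (M.R1 X X⊆E))

    contract-R2 : ∀ X Y → Y ⊆ M.E ─ F → X ⊆ Y → M.r (X ∪ F) ∸ M.r F ≤ M.r (Y ∪ F) ∸ M.r F
    contract-R2 X Y Y⊆E─F X⊆Y =
      ∸-monoˡ-≤ (M.r F) (r-mono (∪-least (⊆E─F⇒⊆E Y⊆E─F) F⊆E) (∪-monoˡ-⊆ X⊆Y))

    contract-R3 : ∀ X Y → X ⊆ M.E ─ F → Y ⊆ M.E ─ F →
      (M.r ((X ∪ Y) ∪ F) ∸ M.r F) + (M.r ((X ∩ Y) ∪ F) ∸ M.r F) ≤
      (M.r (X ∪ F) ∸ M.r F) + (M.r (Y ∪ F) ∸ M.r F)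
    contract-R3 X Y X⊆E─F Y⊆E─F = begin
      (M.r ((X ∪ Y) ∪ F) ∸ M.r F) + (M.r ((X ∩ Y) ∪ F) ∸ M.r F)
        ≡⟨ [m∸o]+[n∸o]≡[m+n]∸[o+o] (rF≤r[X∪F] (∪-least X⊆E Y⊆E)) (rF≤r[X∪F] X∩Y⊆E) ⟩
      (M.r ((X ∪ Y) ∪ F) + M.r ((X ∩ Y) ∪ F)) ∸ (M.r F + M.r F)
        ≡⟨ cong₂ (λ U V → (M.r U + M.r V) ∸ (M.r F + M.r F))
                 (∪-distribʳ-∪ X Y F) (sym (∪-distribʳ-∩ F X Y)) ⟨
      (M.r ((X ∪ F) ∪ (Y ∪ F)) + M.r ((X ∪ F) ∩ (Y ∪ F))) ∸ (M.r F + M.r F)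
        ≤⟨ ∸-monoˡ-≤ (M.r F + M.r F) (r-submodular (∪-least X⊆E F⊆E) (∪-least Y⊆E F⊆E)) ⟩
      (M.r (X ∪ F) + M.r (Y ∪ F)) ∸ (M.r F + M.r F)
        ≡⟨ [m∸o]+[n∸o]≡[m+n]∸[o+o] (rF≤r[X∪F] X⊆E) (rF≤r[X∪F] Y⊆E) ⟨
      (M.r (X ∪ F) ∸ M.r F) + (M.r (Y ∪ F) ∸ M.r F) ∎
      where
      open ≤-Reasoning
      X⊆E : X ⊆ M.E
      X⊆E = ⊆E─F⇒⊆E X⊆E─F
      Y⊆E : Y ⊆ M.E
      Y⊆E = ⊆E─F⇒⊆E Y⊆E─F
      X∩Y⊆E : X ∩ Y ⊆ M.E
      X∩Y⊆E = ⊆-trans (p∩q⊆p X Y) X⊆E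

  rankOf-contract : F ⊆ M.E → rankOf (contract M F) ≡ M.r M.E ∸ M.r F
  rankOf-contract {F} F⊆E = cong (λ U → M.r U ∸ M.r F) (p⊆q⇒q─p∪p≡q F⊆E)

  flat⇒singleton-independent : IsFlat M F → z ∈ M.E ─ F → Independent (contract M F) ⁅ z ⁆
  flat⇒singleton-independent {F} {z} flat z∈E─F = x∈p⇒⁅x⁆⊆p z∈E─F , (begin
    M.r (⁅ z ⁆ ∪ F) ∸ M.r F   ≡⟨ cong (λ U → M.r U ∸ M.r F) (∪-comm ⁅ z ⁆ F) ⟩
    M.r (F ∪ ⁅ z ⁆) ∸ M.r F   ≡⟨ cong (_∸ M.r F) (flat-r-∪⁅⁆ flat z∈E z∉F) ⟩
    suc (M.r F) ∸ M.r F       ≡⟨ m+n∸n≡m 1 (M.r F) ⟩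
    1                         ≡⟨ ∣⁅x⁆∣≡1 z ⟨
    ∣ ⁅ z ⁆ ∣                 ∎)
    where
    open ≡-Reasoning
    z∈E : z ∈ M.E
    z∈E = p─q⊆p M.E F z∈E─F
    z∉F : z ∉ F
    z∉F = proj₂ (x∈p─q⁻ M.E F z∈E─F)

  contract-contract : ∀ {F F′} (F⊆F′ : F ⊆ F′) (F′⊆E : F′ ⊆ M.E) →
                      contract M F′ ≋ contract (contraction (⊆-trans F⊆F′ F′⊆E)) (F′ ─ F)
  contract-contract {F} {F′} F⊆F′ F′⊆E = p⊆q⇒s─q≡s─p─[q─p] F⊆F′ , λ X _ → sym (begin
    (M.r ((X ∪ (F′ ─ F)) ∪ F) ∸ M.r F) ∸ (M.r ((F′ ─ F) ∪ F) ∸ M.r F)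
      ≡⟨ cong₂ (λ U V → (M.r U ∸ M.r F) ∸ (M.r V ∸ M.r F))
               (trans (∪-assoc X (F′ ─ F) F) (cong (X ∪_) F′─F∪F≡F′)) F′─F∪F≡F′ ⟩
    (M.r (X ∪ F′) ∸ M.r F) ∸ (M.r F′ ∸ M.r F)
      ≡⟨ [m∸o]∸[n∸o]≡m∸n (M.r (X ∪ F′)) (r-mono F′⊆E F⊆F′) ⟩
    M.r (X ∪ F′) ∸ M.r F′ ∎)
    where
    open ≡-Reasoning
    F′─F∪F≡F′ : (F′ ─ F) ∪ F ≡ F′
    F′─F∪F≡F′ = p⊆q⇒q─p∪p≡q F⊆F′

  module _ (H⊆E : H ⊆ M.E) (B-basis : Basis H B) where

    private
      B⊆H : B ⊆ H
      B⊆H = proj₁ B-basis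
      rB≡∣B∣ : M.r B ≡ ∣ B ∣
      rB≡∣B∣ = proj₂ (proj₁ (proj₂ B-basis))
      rB≡rH : M.r B ≡ M.r H
      rB≡rH = proj₂ (proj₂ B-basis)

    r[X∪B]≡r/H[X]+∣B∣ : X ⊆ M.E ─ H → M.r (X ∪ B) ≡ rk (contract M H) X + ∣ B ∣
    r[X∪B]≡r/H[X]+∣B∣ {X} X⊆E─H = begin
      M.r (X ∪ B)                     ≡⟨ r-∪-spanning H⊆E B⊆H rB≡rH X⊆E ⟩
      M.r (X ∪ H)                     ≡⟨ m∸n+n≡m (r-mono (∪-least X⊆E H⊆E) (q⊆p∪q X H)) ⟨
      (M.r (X ∪ H) ∸ M.r H) + M.r H   ≡⟨ cong (M.r (X ∪ H) ∸ M.r H +_) (trans (sym rB≡rH) rB≡∣B∣) ⟩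
      (M.r (X ∪ H) ∸ M.r H) + ∣ B ∣   ∎
      where
      open ≡-Reasoning
      X⊆E : X ⊆ M.E
      X⊆E = ⊆E─F⇒⊆E X⊆E─H

    ∣X∪B∣≡∣X∣+∣B∣ : X ⊆ M.E ─ H → ∣ X ∪ B ∣ ≡ ∣ X ∣ + ∣ B ∣
    ∣X∪B∣≡∣X∣+∣B∣ {X} X⊆E─H =
      ∣p∪q∣≡∣p∣+∣q∣ X B λ x∈X x∈B → proj₂ (x∈p─q⁻ M.E H (X⊆E─H x∈X)) (B⊆H x∈B)

    ∪-basis-independent : Independent (contract M H) X → Independent M.rankData (X ∪ B)
    ∪-basis-independent {X} (X⊆E─H , X-indep) = ∪-least (⊆E─F⇒⊆E X⊆E─H) (⊆-trans B⊆H H⊆E) , (begin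
      M.r (X ∪ B)                     ≡⟨ r[X∪B]≡r/H[X]+∣B∣ X⊆E─H ⟩
      rk (contract M H) X + ∣ B ∣     ≡⟨ cong (_+ ∣ B ∣) X-indep ⟩
      ∣ X ∣ + ∣ B ∣                   ≡⟨ ∣X∪B∣≡∣X∣+∣B∣ X⊆E─H ⟨
      ∣ X ∪ B ∣                       ∎)
      where open ≡-Reasoning

    ∪-basis-dependent : X ⊆ M.E ─ H → rk (contract M H) X < ∣ X ∣ → M.r (X ∪ B) < ∣ X ∪ B ∣
    ∪-basis-dependent {X} X⊆E─H X-dep = begin-strict
      M.r (X ∪ B)                     ≡⟨ r[X∪B]≡r/H[X]+∣B∣ X⊆E─H ⟩
      rk (contract M H) X + ∣ B ∣     <⟨ +-monoˡ-< ∣ B ∣ X-dep ⟩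
      ∣ X ∣ + ∣ B ∣                   ≡⟨ ∣X∪B∣≡∣X∣+∣B∣ X⊆E─H ⟨
      ∣ X ∪ B ∣                       ∎
      where open ≤-Reasoning

    circuit⊆C′∪B⇒C′⊆circuit : ∀ {C′ C} → IsCircuit (contract M H) C′ →
                              IsCircuit M.rankData C → C ⊆ C′ ∪ B → C′ ⊆ C
    circuit⊆C′∪B⇒C′⊆circuit {C′} {C} (_ , _ , C′-minimal) (_ , C-dep , _) C⊆C′∪B {x} x∈C′
      with x ∈? C
    ... | yes x∈C = x∈C
    ... | no x∉C = ⊥-elim (<⇒≢ C-dep (proj₂ (independent-⊆ [C′-x]∪B-indep C⊆[C′-x]∪B)))
      where
      [C′-x]∪B-indep : Independent M.rankData ((C′ - x) ∪ B)
      [C′-x]∪B-indep = ∪-basis-independent (C′-minimal x x∈C′)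
      C⊆[C′-x]∪B : C ⊆ (C′ - x) ∪ B
      C⊆[C′-x]∪B w∈C = [ (λ w∈C′ → p⊆p∪q B (x∈p∧x≢y⇒x∈p-y w∈C′ λ { refl → x∉C w∈C }))
                       , q⊆p∪q (C′ - x) B
                       ]′ (x∈p∪q⁻ C′ B (C⊆C′∪B w∈C))

  circuit-of-contraction-extends : ∀ {C′} → H ⊆ M.E → IsCircuit (contract M H) C′ →
                                   ∃ λ C → IsCircuit M.rankData C × C′ ⊆ C
  circuit-of-contraction-extends {H} {C′} H⊆E C′-circuit@(C′⊆E─H , C′-dep , _) =
    let (B , B-basis@(B⊆H , _)) = basis H⊆E
        (C , C-circuit , C⊆C′∪B) = dependent⇒circuit (∪-least (⊆E─F⇒⊆E C′⊆E─H) (⊆-trans B⊆H H⊆E))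
                                                      (∪-basis-dependent H⊆E B-basis C′⊆E─H C′-dep)
    in C , C-circuit , circuit⊆C′∪B⇒C′⊆circuit H⊆E B-basis C′-circuit C-circuit C⊆C′∪B

InCommonCircuit-contract-antitone : ∀ (M : Matroid n) {F F′} → F ⊆ F′ → F′ ⊆ E M →
  InCommonCircuit (contract M F′) x y → InCommonCircuit (contract M F) x y
InCommonCircuit-contract-antitone M {F} {F′} F⊆F′ F′⊆E (C′ , C′-circuit , x∈C′ , y∈C′) =
  let (C , C-circuit , C′⊆C) =
        MatroidTheory.circuit-of-contraction-extends (contraction (⊆-trans F⊆F′ F′⊆E))
          (p⊆q⇒p─s⊆q─s F′⊆E)
          (IsCircuit-resp-≋ (contract-contract F⊆F′ F′⊆E) C′-circuit)
  in C , C-circuit , C′⊆C x∈C′ , C′⊆C y∈C′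
  where open MatroidTheory M

DisconnectsToRank2 : Matroid n → Subset n → Set
DisconnectsToRank2 M F = IsFlat M F × ¬ Connected (contract M F) × rankOf (contract M F) ≡ 2

disconnectsToRank2? : (M : Matroid n) → Decidable (DisconnectsToRank2 M)
disconnectsToRank2? M F =
  isFlat? M F ×-dec ¬? (connected? (contract M F)) ×-dec (rankOf (contract M F) ≟ 2)

module _ {n : ℕ} (M : Matroid n) where

  open MatroidTheory M
  private
    module M = Matroid M
    variable
      F : Subset n
      z : Fin n

  record Disconnecting (F : Subset n) (x y : Fin n) : Set where
    field
      flat              : IsFlat M F
      x∈E─F             : x ∈ M.E ─ F
      y∈E─F             : y ∈ M.E ─ F
      x≢y               : x ≢ y
      no-common-circuit : ¬ InCommonCircuit (contract M F) x y

  Disconnecting⇒¬Connected : Disconnecting F x y → ¬ Connected (contract M F)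
  Disconnecting⇒¬Connected d connected = no-common-circuit (connected _ _ x∈E─F y∈E─F x≢y)
    where open Disconnecting d

  corank≤1⇒InCommonCircuit : IsFlat M F → M.r M.E ≤ suc (M.r F) →
                             x ∈ M.E ─ F → y ∈ M.E ─ F → x ≢ y → InCommonCircuit (contract M F) x y
  corank≤1⇒InCommonCircuit {F} {x} {y} flat corank≤1 x∈E─F y∈E─F x≢y =
    P , (P⊆E─F , P-dependent , P-minimal) , p⊆p∪q ⁅ y ⁆ (x∈⁅x⁆ x) , q⊆p∪q ⁅ x ⁆ ⁅ y ⁆ (x∈⁅x⁆ y)
    where
    P : Subset n
    P = ⁅ x ⁆ ∪ ⁅ y ⁆
    P⊆E─F : P ⊆ M.E ─ F
    P⊆E─F = ∪-least (x∈p⇒⁅x⁆⊆p x∈E─F) (x∈p⇒⁅x⁆⊆p y∈E─F)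
    P-dependent : M.r (P ∪ F) ∸ M.r F < ∣ P ∣
    P-dependent = begin-strict
      M.r (P ∪ F) ∸ M.r F   ≤⟨ ∸-monoˡ-≤ (M.r F) (≤-trans (r-mono ⊆-refl P∪F⊆E) corank≤1) ⟩
      suc (M.r F) ∸ M.r F   ≡⟨ m+n∸n≡m 1 (M.r F) ⟩
      1                     <⟨ n<1+n 1 ⟩
      2                     ≡⟨ ∣⁅x⁆∪⁅y⁆∣≡2 x≢y ⟨
      ∣ P ∣                 ∎
      where
      open ≤-Reasoning
      P∪F⊆E : P ∪ F ⊆ M.E
      P∪F⊆E = ∪-least (⊆E─F⇒⊆E P⊆E─F) (proj₁ flat)
    P-minimal : ∀ w → w ∈ P → Independent (contract M F) (P - w)
    P-minimal w w∈P with x∈p∪q⁻ ⁅ x ⁆ ⁅ y ⁆ w∈P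
    ... | inj₁ w∈⁅x⁆ rewrite x∈⁅y⁆⇒x≡y x w∈⁅x⁆ | ⁅x⁆∪⁅y⁆-x≡⁅y⁆ x≢y =
      flat⇒singleton-independent flat y∈E─F
    ... | inj₂ w∈⁅y⁆ rewrite x∈⁅y⁆⇒x≡y y w∈⁅y⁆ | ∪-comm ⁅ x ⁆ ⁅ y ⁆ | ⁅x⁆∪⁅y⁆-x≡⁅y⁆ (x≢y ∘ sym) =
      flat⇒singleton-independent flat x∈E─F

  F∪x∪y⊆E : Disconnecting F x y → F ∪ (⁅ x ⁆ ∪ ⁅ y ⁆) ⊆ M.E
  F∪x∪y⊆E d = ∪-least (proj₁ flat) (⊆E─F⇒⊆E (∪-least (x∈p⇒⁅x⁆⊆p x∈E─F) (x∈p⇒⁅x⁆⊆p y∈E─F)))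
    where open Disconnecting d

  Disconnecting-cl-∪-unspanned : Disconnecting F x y → z ∈ M.E → ¬ Spans (F ∪ (⁅ x ⁆ ∪ ⁅ y ⁆)) z →
                                 Disconnecting (cl (F ∪ ⁅ z ⁆)) x y
  Disconnecting-cl-∪-unspanned {F} {x} {y} {z} d z∈E ¬spans = record
    { flat              = cl-flat F∪z⊆E
    ; x∈E─F             = ∉cl[F∪z] x∈E─F (∪-monoʳ-⊆ (p⊆p∪q ⁅ y ⁆))
    ; y∈E─F             = ∉cl[F∪z] y∈E─F (∪-monoʳ-⊆ (q⊆p∪q ⁅ x ⁆ ⁅ y ⁆))
    ; x≢y               = x≢y
    ; no-common-circuit = no-common-circuit ∘ InCommonCircuit-contract-antitone M F⊆cl[F∪z] cl⊆E
    }
    where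
    open Disconnecting d
    F∪z⊆E : F ∪ ⁅ z ⁆ ⊆ M.E
    F∪z⊆E = ∪-least (proj₁ flat) (x∈p⇒⁅x⁆⊆p z∈E)
    F⊆cl[F∪z] : F ⊆ cl (F ∪ ⁅ z ⁆)
    F⊆cl[F∪z] = ⊆cl F∪z⊆E ∘ p⊆p∪q ⁅ z ⁆
    ∉cl[F∪z] : ∀ {w} → w ∈ M.E ─ F → F ∪ ⁅ w ⁆ ⊆ F ∪ (⁅ x ⁆ ∪ ⁅ y ⁆) → w ∈ M.E ─ cl (F ∪ ⁅ z ⁆)
    ∉cl[F∪z] {w} w∈E─F F∪w⊆F∪x∪y = x∈p∧x∉q⇒x∈p─q w∈E λ w∈cl →
      ¬spans (Spans-mono F∪w⊆F∪x∪y (F∪x∪y⊆E d) z∈E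
                         (flat-exchange flat w∈E w∉F z∈E (proj₂ (x∈cl⁻ w∈cl))))
      where
      w∈E : w ∈ M.E
      w∈E = p─q⊆p M.E F w∈E─F
      w∉F : w ∉ F
      w∉F = proj₂ (x∈p─q⁻ M.E F w∈E─F)

  Disconnecting-raise : Disconnecting F x y → suc (suc (M.r F)) < M.r M.E →
                        ∃ λ F′ → Disconnecting F′ x y × M.r F′ ≡ suc (M.r F)
  Disconnecting-raise {F} {x} {y} d rF+2<rE =
    let (z , z∈E , ¬spans) = ∃-unspanned (F∪x∪y⊆E d) r[F∪x∪y]<rE
        z∉F : z ∉ F
        z∉F z∈F = ¬spans (≤-reflexive (cong M.r (x∈p⇒p∪⁅x⁆≡p (p⊆p∪q _ z∈F))))
    in cl (F ∪ ⁅ z ⁆) , Disconnecting-cl-∪-unspanned d z∈E ¬spans ,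
       trans (r-cl (∪-least F⊆E (x∈p⇒⁅x⁆⊆p z∈E))) (flat-r-∪⁅⁆ flat z∈E z∉F)
    where
    open Disconnecting d
    F⊆E : F ⊆ M.E
    F⊆E = proj₁ flat
    x∪y⊆E : ⁅ x ⁆ ∪ ⁅ y ⁆ ⊆ M.E
    x∪y⊆E = ⊆E─F⇒⊆E (∪-least (x∈p⇒⁅x⁆⊆p x∈E─F) (x∈p⇒⁅x⁆⊆p y∈E─F))
    r[F∪x∪y]<rE : M.r (F ∪ (⁅ x ⁆ ∪ ⁅ y ⁆)) < M.r M.E
    r[F∪x∪y]<rE = begin-strict
      M.r (F ∪ (⁅ x ⁆ ∪ ⁅ y ⁆))       ≤⟨ r-∪≤+ F⊆E x∪y⊆E ⟩
      M.r F + M.r (⁅ x ⁆ ∪ ⁅ y ⁆)     ≤⟨ +-monoʳ-≤ (M.r F) (M.R1 _ x∪y⊆E) ⟩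
      M.r F + ∣ ⁅ x ⁆ ∪ ⁅ y ⁆ ∣       ≡⟨ cong (M.r F +_) (∣⁅x⁆∪⁅y⁆∣≡2 x≢y) ⟩
      M.r F + 2                       ≡⟨ +-comm (M.r F) 2 ⟩
      suc (suc (M.r F))               <⟨ rF+2<rE ⟩
      M.r M.E                         ∎
      where open ≤-Reasoning

  descend : ∀ k → M.r M.E ≡ k + M.r F → Disconnecting F x y → ∃ (DisconnectsToRank2 M)
  descend 0 rE≡rF d = ⊥-elim (no-common-circuit
    (corank≤1⇒InCommonCircuit flat (≤-trans (≤-reflexive rE≡rF) (n≤1+n _)) x∈E─F y∈E─F x≢y))
    where open Disconnecting d
  descend 1 rE≡1+rF d = ⊥-elim (no-common-circuit
    (corank≤1⇒InCommonCircuit flat (≤-reflexive rE≡1+rF) x∈E─F y∈E─F x≢y))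
    where open Disconnecting d
  descend {F = F} 2 rE≡2+rF d = F , flat , Disconnecting⇒¬Connected d , (begin
    rankOf (contract M F)   ≡⟨ rankOf-contract (proj₁ flat) ⟩
    M.r M.E ∸ M.r F         ≡⟨ cong (_∸ M.r F) rE≡2+rF ⟩
    (2 + M.r F) ∸ M.r F     ≡⟨ m+n∸n≡m 2 (M.r F) ⟩
    2                       ∎)
    where
    open Disconnecting d
    open ≡-Reasoning
  descend {F = F} (suc (suc (suc k))) rE≡3+k+rF d =
    let (F′ , d′ , rF′≡1+rF) = Disconnecting-raise d rF+2<rE
    in descend (suc (suc k)) (rE≡2+k+rF′ rF′≡1+rF) d′
    where
    rF+2<rE : suc (suc (M.r F)) < M.r M.E
    rF+2<rE = ≤-trans (+-monoʳ-≤ 3 (m≤n+m (M.r F) k)) (≤-reflexive (sym rE≡3+k+rF))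
    rE≡2+k+rF′ : ∀ {F′} → M.r F′ ≡ suc (M.r F) → M.r M.E ≡ 2 + k + M.r F′
    rE≡2+k+rF′ {F′} rF′≡1+rF = begin
      M.r M.E               ≡⟨ rE≡3+k+rF ⟩
      3 + k + M.r F         ≡⟨ +-suc (2 + k) (M.r F) ⟨
      2 + k + suc (M.r F)   ≡⟨ cong (2 + k +_) rF′≡1+rF ⟨
      2 + k + M.r F′        ∎
      where open ≡-Reasoning

lemma6p1 : ∀ {n} (M : Matroid n) → Connected (rankData M) → ¬ Unbreakable M →
    Σ (Subset n) λ F → IsFlat M F × ¬ Connected (contract M F) × rankOf (contract M F) ≡ 2
lemma6p1 M connected ¬unbreakable = decidable-stable (anySubset? (disconnectsToRank2? M)) λ none →
  ¬unbreakable (connected , λ F flat x y x∈E─F y∈E─F x≢y →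
    decidable-stable (inCommonCircuit? (contract M F) x y) λ no-common-circuit →
      none (descend M (r M (E M) ∸ r M F) (sym (m∸n+n≡m (R2 M F (E M) ⊆-refl (proj₁ flat))))
                    (record { flat = flat ; x∈E─F = x∈E─F ; y∈E─F = y∈E─F ; x≢y = x≢y
                            ; no-common-circuit = no-common-circuit })))
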